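{- Let $n$ be an even integer and let $H$ be a graph on $n$ vertices with minimum degree at least $\lceil n/4\rceil$, such that $H$ consists of exactly two connected components $C_1$ and $C_2$, both factor-critical, with $|C_1|\le |C_2|$. Let $M$ be a perfect matching of the complement of $H$. Let $M'$ be a perfect matching of the graph $H\cup M$ such that the graph $(H\cup M)-M'$ consists of exactly two connected components $C_1'$ and $C_2'$, both factor-critical, with $|C_1'|\le |C_2'|$. Suppose that $E_M(C_1,C_2)\setminus M'\neq\emptyset$. Then $V(C_1')\subset V(C_2)$; equivalently, $V(C_1)\cap V(C_1')=\emptyset$ and $V(C_2)\cap V(C_2')\neq\emptyset$.
   Context: All graphs are finite, simple, and undirected. A graph $G$ is factor-critical if $G-v$ has a perfect matching for every vertex $v$. For a graph $H$ and an edge set $M$ (on the same vertex set), $H\cup M$ denotes the graph with edge set $E(H)\cup M$, and $(H\cup M)-M'$ denotes the graph obtained by deleting the edges of $M'$. For vertex sets (or subgraphs) $X,Y$, $E_M(X,Y)$ denotes the set of edges of $M$ with one end in $X$ and the other in $Y$. -}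

module Defs where

open import Data.Nat using (ℕ; zero; suc; _+_; _≤_; _/_)
open import Data.Bool using (Bool; true; false; _∧_; _∨_; not; if_then_else_)
open import Data.Fin using (Fin; _≟_)
open import Data.List using (List; length; filter)
open import Data.List using (allFin)
open import Data.Product using (Σ; ∃; ∃-syntax; _×_; _,_)
open import Data.Empty using (⊥)
open import Relation.Nullary using (¬_; does)
open import Relation.Binary.PropositionalEquality using (_≡_)

-- Edge sets on the same
-- vertex set (e.g. matchings) are also represented this way.
record Graph (n : ℕ) : Set where
  field
    adj   : Fin n → Fin n → Bool
    sym   : ∀ u v → adj u v ≡ adj v u
    irrfl : ∀ v → adj v v ≡ false
open Graph public

VSet : ℕ → Set
VSet n = Fin n → Bool

_∈_ : ∀ {n} → Fin n → VSet n → Set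
v ∈ S = S v ≡ true

size : ∀ {n} → VSet n → ℕ
size {n} S = length (filter (λ v → S v Data.Bool.≟ true) (allFin n))

degree : ∀ {n} → Graph n → Fin n → ℕ
degree G v = size (adj G v)

⌈_/4⌉ : ℕ → ℕ
⌈ n /4⌉ = (n + 3) / 4

complement : ∀ {n} → Graph n → Graph n
complement {n} G = record
  { adj = λ u v → not (adj G u v) ∧ not (does (u ≟ v))
  ; sym = symC
  ; irrfl = irC }
  where
  open import Relation.Binary.PropositionalEquality using (refl; cong₂; cong; sym)
  open import Relation.Nullary using (yes; no)
  symC : ∀ u v → not (adj G u v) ∧ not (does (u ≟ v)) ≡ not (adj G v u) ∧ not (does (v ≟ u))
  symC u v with u ≟ v | v ≟ u
  ... | yes p | yes q = cong₂ (λ a b → not a ∧ b) (Graph.sym G u v) refl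
  ... | no p  | no q  = cong₂ (λ a b → not a ∧ b) (Graph.sym G u v) refl
  ... | yes p | no q  = Data.Empty.⊥-elim (q (Relation.Binary.PropositionalEquality.sym p))
  ... | no p  | yes q = Data.Empty.⊥-elim (p (Relation.Binary.PropositionalEquality.sym q))
  irC : ∀ v → not (adj G v v) ∧ not (does (v ≟ v)) ≡ false
  irC v with v ≟ v
  ... | yes _ = Data.Bool.Properties.∧-zeroʳ (not (adj G v v))
    where import Data.Bool.Properties
  ... | no ¬p = Data.Empty.⊥-elim (¬p refl)

_∪E_ : ∀ {n} → Graph n → Graph n → Graph n
G ∪E M = record
  { adj = λ u v → adj G u v ∨ adj M u v
  ; sym = λ u v → cong₂ _∨_ (Graph.sym G u v) (Graph.sym M u v)
  ; irrfl = λ v → subst₂ (λ a b → a ∨ b ≡ false) (Relation.Binary.PropositionalEquality.sym (irrfl G v)) (Relation.Binary.PropositionalEquality.sym (irrfl M v)) refl }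
  where open import Relation.Binary.PropositionalEquality using (cong₂; subst₂; refl)

_∖E_ : ∀ {n} → Graph n → Graph n → Graph n
G ∖E M = record
  { adj = λ u v → adj G u v ∧ not (adj M u v)
  ; sym = λ u v → cong₂ (λ a b → a ∧ not b) (Graph.sym G u v) (Graph.sym M u v)
  ; irrfl = λ v → subst (λ a → a ∧ not (adj M v v) ≡ false) (Relation.Binary.PropositionalEquality.sym (irrfl G v)) refl }
  where open import Relation.Binary.PropositionalEquality using (cong₂; subst; refl)

V : ∀ {n} → VSet n
V _ = true

_─_ : ∀ {n} → VSet n → Fin n → VSet n
(S ─ v) u = S u ∧ not (does (u ≟ v))

IsPerfectMatching : ∀ {n} → Graph n → VSet n → Graph n → Set
IsPerfectMatching {n} G S P =
  (∀ u w → adj P u w ≡ true → (adj G u w ≡ true × u ∈ S × w ∈ S)) ×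
  (∀ u → u ∈ S → ∃[ w ] (adj P u w ≡ true × (∀ w' → adj P u w' ≡ true → w' ≡ w)))

FactorCritical : ∀ {n} → Graph n → VSet n → Set
FactorCritical {n} G S = ∀ v → v ∈ S → Σ (Graph n) λ P → IsPerfectMatching G (S ─ v) P

data Reach {n} (G : Graph n) (S : VSet n) (u : Fin n) : Fin n → Set where
  here : u ∈ S → Reach G S u u
  step : ∀ {w v} → Reach G S u w → adj G w v ≡ true → v ∈ S → Reach G S u v

Connected : ∀ {n} → Graph n → VSet n → Set
Connected G S = (∃[ v ] v ∈ S) × (∀ u v → u ∈ S → v ∈ S → Reach G S u v)

TwoComponents : ∀ {n} → Graph n → VSet n → VSet n → Set
TwoComponents G C₁ C₂ =
  (∀ v → (v ∈ C₁ × ¬ v ∈ C₂) Data.Sum.⊎ (¬ v ∈ C₁ × v ∈ C₂)) ×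
  Connected G C₁ × Connected G C₂ ×
  (∀ u v → u ∈ C₁ → v ∈ C₂ → adj G u v ≡ false)
  where import Data.Sum

module Submission where

-- Let u ∈ C₁, v ∈ C₂ with uv ∈ M ∖ M'; then uv is an edge of
-- G' = (H ∪ M) − M', so u and v lie in the same component of G'.
--   * Key estimate: if a component A of H and a component A' of G' share a
--     vertex x, then |A ∩ A'| ≥ ⌈n/4⌉, because x and all its H-neighbours
--     except its M'-partner stay in A ∩ A' (and deg_H x ≥ ⌈n/4⌉).
--   * Parity: a factor-critical component has odd order, and the smaller
--     of two components has at most n/2 vertices.  An odd number c ≤ n/2
--     is < 2⌈n/4⌉, so such a component cannot contain two disjoint sets of
--     size ≥ ⌈n/4⌉.
-- If u, v ∈ C₁', then C₁' contains the disjoint sets C₁ ∩ C₁' and C₂ ∩ C₁',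
-- both large: impossible.  So u, v ∈ C₂', whence v ∈ C₂ ∩ C₂'; and a vertex
-- x ∈ C₁ ∩ C₁' would make C₁ ∩ C₁' and C₁ ∩ C₂' (which contains u) two
-- large disjoint subsets of C₁: impossible, so C₁' ⊆ C₂.

open import Defs hiding (sym)
open import Data.Nat using (ℕ; zero; suc; _+_; _*_; _≤_; s≤s; z≤n; _%_)
open import Data.Nat.Properties
open import Data.Nat.DivMod using (m≡m%n+[m/n]*n; m%n<n)
open import Data.Nat.Divisibility using (_∣_; _∣0; ∣-refl; ∣m∣n⇒∣m+n; ∣m+n∣m⇒∣n; ∣1⇒≡1; m∣m*n)
open import Data.Bool using (Bool; true; false; _∧_)
import Data.Bool
open import Data.Bool.Properties using (∧-identityʳ; ∨-zeroʳ)
open import Data.Fin using (Fin)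
import Data.Fin as F
open import Data.Fin.Properties using (any?)
open import Data.List using (length; filter; tabulate)
open import Data.Product using (∃-syntax; _×_; _,_; proj₁; proj₂)
import Data.Product as Product
open import Data.Sum using (_⊎_; inj₁; inj₂)
import Data.Sum as Sum
open import Data.Empty using (⊥; ⊥-elim)
open import Function using (_∘_)
open import Relation.Nullary using (¬_; yes; no; does)
open import Relation.Binary.PropositionalEquality
open import Algebra.Properties.CommutativeSemigroup +-commutativeSemigroup using (interchange)

false≢true : false ≢ true
false≢true ()

ι : Bool → ℕ
ι true = 1
ι false = 0

count : ∀ {n} → VSet n → ℕ
count {zero} S = 0
count {suc n} S = ι (S F.zero) + count (S ∘ F.suc)

size-tabulate : ∀ {m} n (f : Fin n → Fin m) (S : VSet m) →
  length (filter (λ v → S v Data.Bool.≟ true) (tabulate f)) ≡ count (S ∘ f)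
size-tabulate zero f S = refl
size-tabulate (suc n) f S with S (f F.zero)
... | true = cong suc (size-tabulate n (f ∘ F.suc) S)
... | false = size-tabulate n (f ∘ F.suc) S

size≡count : ∀ {n} (S : VSet n) → size S ≡ count S
size≡count {n} S = size-tabulate n (λ i → i) S

count-compare : ∀ {n} (P Q R S : VSet n) →
  (∀ v → ι (P v) + ι (Q v) ≤ ι (R v) + ι (S v)) →
  count P + count Q ≤ count R + count S
count-compare {zero} P Q R S h = z≤n
count-compare {suc n} P Q R S h = begin
  (p + P') + (q + Q') ≡⟨ interchange p P' q Q' ⟩
  (p + q) + (P' + Q') ≤⟨ +-mono-≤ (h F.zero) (count-compare _ _ _ _ (h ∘ F.suc)) ⟩
  (r + s) + (R' + S') ≡⟨ interchange r s R' S' ⟩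
  (r + R') + (s + S') ∎
  where
  open ≤-Reasoning
  p = ι (P F.zero); q = ι (Q F.zero); r = ι (R F.zero); s = ι (S F.zero)
  P' = count (P ∘ F.suc); Q' = count (Q ∘ F.suc)
  R' = count (R ∘ F.suc); S' = count (S ∘ F.suc)

∅ : ∀ {n} → VSet n
∅ _ = false

⁅_⁆ : ∀ {n} → Fin n → VSet n
⁅ x ⁆ w = does (w F.≟ x)

_∩_ : ∀ {n} → VSet n → VSet n → VSet n
(A ∩ B) w = A w ∧ B w

_⊆_ : ∀ {n} → VSet n → VSet n → Set
S ⊆ T = ∀ v → v ∈ S → v ∈ T

∩-intro : ∀ {n} {A B : VSet n} {v} → v ∈ A → v ∈ B → v ∈ (A ∩ B)
∩-intro v∈A v∈B rewrite v∈A = v∈B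

∩-elimˡ : ∀ {n} (A B : VSet n) → (A ∩ B) ⊆ A
∩-elimˡ A B v v∈A∩B with A v
... | true = refl

∩-elimʳ : ∀ {n} (A B : VSet n) → (A ∩ B) ⊆ B
∩-elimʳ A B v v∈A∩B with A v
... | true = v∈A∩B

count-∅ : ∀ {n} → count (∅ {n}) ≡ 0
count-∅ {zero} = refl
count-∅ {suc n} = count-∅ {n}

count-V : ∀ {n} → count (V {n}) ≡ n
count-V {zero} = refl
count-V {suc n} = cong suc (count-V {n})

count-⁅⁆ : ∀ {n} (x : Fin n) → count ⁅ x ⁆ ≡ 1
count-⁅⁆ {suc n} F.zero = cong suc (count-∅ {n})
count-⁅⁆ (F.suc x) = count-⁅⁆ x

⁅⁆-self : ∀ {n} (x : Fin n) → x ∈ ⁅ x ⁆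
⁅⁆-self x with x F.≟ x
... | yes _ = refl
... | no x≢x = ⊥-elim (x≢x refl)

count-disjoint : ∀ {n} {S T C : VSet n} → S ⊆ C → T ⊆ C → (∀ v → v ∈ S → v ∈ T → ⊥) →
  count S + count T ≤ count C
count-disjoint {n} {S} {T} {C} S⊆C T⊆C disjoint =
  subst (count S + count T ≤_) (trans (cong (count C +_) (count-∅ {n})) (+-identityʳ (count C)))
    (count-compare S T C ∅ pointwise)
  where
  pointwise : ∀ v → ι (S v) + ι (T v) ≤ ι (C v) + 0
  pointwise v with S v in s | T v in t
  ... | true | true = ⊥-elim (disjoint v s t)
  ... | true | false rewrite S⊆C v s = ≤-refl
  ... | false | true rewrite T⊆C v t = ≤-refl
  ... | false | false = z≤n

count-none : ∀ {n} (S : VSet n) → (∀ v → ¬ v ∈ S) → count S ≡ 0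
count-none {zero} S none = refl
count-none {suc n} S none with S F.zero in s
... | true = ⊥-elim (none F.zero s)
... | false = count-none (S ∘ F.suc) (none ∘ F.suc)

─-intro : ∀ {n} (S : VSet n) {x v} → v ∈ S → v ≢ x → v ∈ (S ─ x)
─-intro S {x} {v} v∈S v≢x with v F.≟ x
... | yes v≡x = ⊥-elim (v≢x v≡x)
... | no _ rewrite v∈S = refl

─-elim : ∀ {n} (S : VSet n) {x v} → v ∈ (S ─ x) → v ∈ S × v ≢ x
─-elim S {x} {v} v∈S─x with v F.≟ x | S v
... | no v≢x | true = refl , v≢x
... | yes _ | true = ⊥-elim (false≢true v∈S─x)
... | _ | false = ⊥-elim (false≢true v∈S─x)

count-remove : ∀ {n} {S : VSet n} x → x ∈ S → count S ≡ suc (count (S ─ x))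
count-remove {n} {S} x x∈S = begin
  count S                          ≡⟨ sym (+-identityʳ (count S)) ⟩
  count S + 0                      ≡⟨ cong (count S +_) (sym (count-∅ {n})) ⟩
  count S + count (∅ {n})          ≡⟨ ≤-antisym (count-compare S ∅ (S ─ x) ⁅ x ⁆ (≤-reflexive ∘ split))
                                                (count-compare (S ─ x) ⁅ x ⁆ S ∅ (≤-reflexive ∘ sym ∘ split)) ⟩
  count (S ─ x) + count ⁅ x ⁆      ≡⟨ cong (count (S ─ x) +_) (count-⁅⁆ x) ⟩
  count (S ─ x) + 1                ≡⟨ +-comm (count (S ─ x)) 1 ⟩
  suc (count (S ─ x))              ∎
  where
  open ≡-Reasoning
  split : ∀ v → ι (S v) + 0 ≡ ι ((S ─ x) v) + ι (⁅ x ⁆ v)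
  split v with v F.≟ x
  ... | yes refl rewrite x∈S = refl
  ... | no _ rewrite ∧-identityʳ (S v) = refl

-- P matches S within itself: every vertex of S has exactly one P-neighbour,
-- and that neighbour lies in S.  Unlike IsPerfectMatching, this property
-- survives deleting a matched pair from S.
MatchedWithin : ∀ {n} → Graph n → VSet n → Set
MatchedWithin P S = ∀ x → x ∈ S →
  ∃[ y ] (adj P x y ≡ true × y ∈ S × (∀ y' → adj P x y' ≡ true → y' ≡ y))

perfect⇒matchedWithin : ∀ {n} {G P : Graph n} {S : VSet n} →
  IsPerfectMatching G S P → MatchedWithin P S
perfect⇒matchedWithin (edges , partner) x x∈S with partner x x∈S
... | y , xy∈P , unique = y , xy∈P , proj₂ (proj₂ (edges x y xy∈P)) , unique

remove-pair : ∀ {n} {P : Graph n} {S : VSet n} {x y} → MatchedWithin P S →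
  y ∈ S → adj P x y ≡ true → (∀ y' → adj P x y' ≡ true → y' ≡ y) →
  MatchedWithin P ((S ─ x) ─ y)
remove-pair {P = P} {S} {x} {y} matched y∈S xy∈P x↦y z z∈S₂
  with ─-elim (S ─ x) z∈S₂
... | z∈S₁ , z≢y with ─-elim S z∈S₁
... | z∈S , z≢x with matched z z∈S
... | z' , zz'∈P , z'∈S , z↦z' = z' , zz'∈P , ─-intro (S ─ x) (─-intro S z'∈S z'≢x) z'≢y , z↦z'
  where
  z'≢x : z' ≢ x
  z'≢x refl = z≢y (x↦y z (trans (Graph.sym P x z) zz'∈P))
  z'≢y : z' ≢ y
  z'≢y refl with matched y y∈S
  ... | _ , _ , _ , y↦w =
    z≢x (trans (y↦w z (trans (Graph.sym P y z) zz'∈P)) (sym (y↦w x (trans (Graph.sym P y x) xy∈P))))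

-- A vertex set matched within itself has even size: delete one matched
-- pair at a time, by induction on an upper bound k for the size.
matched⇒even : ∀ {n} (P : Graph n) k (S : VSet n) → count S ≤ k → MatchedWithin P S →
  2 ∣ count S
matched⇒even P zero S bound matched = subst (2 ∣_) (sym (n≤0⇒n≡0 bound)) (2 ∣0)
matched⇒even P (suc k) S bound matched with any? (λ x → S x Data.Bool.≟ true)
... | no empty = subst (2 ∣_) (sym (count-none S λ v v∈S → empty (v , v∈S))) (2 ∣0)
... | yes (x , x∈S) with matched x x∈S
... | y , xy∈P , y∈S , x↦y =
  subst (2 ∣_) (sym count-S) (∣m∣n⇒∣m+n ∣-refl (matched⇒even P k S₂ bound₂ matched₂))
  where
  S₂ = (S ─ x) ─ y
  y≢x : y ≢ x
  y≢x refl = false≢true (trans (sym (irrfl P x)) xy∈P)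
  count-S : count S ≡ 2 + count S₂
  count-S = trans (count-remove x x∈S) (cong suc (count-remove y (─-intro S y∈S y≢x)))
  bound₂ : count S₂ ≤ k
  bound₂ = <⇒≤ (≤-pred (subst (_≤ suc k) count-S bound))
  matched₂ : MatchedWithin P S₂
  matched₂ = remove-pair {P = P} {S} {x} matched y∈S xy∈P x↦y

factorCritical⇒odd : ∀ {n} {G : Graph n} {C : VSet n} {v} → FactorCritical G C → v ∈ C →
  ¬ 2 ∣ count C
factorCritical⇒odd {G = G} {C} {v} critical v∈C 2∣C with critical v v∈C
... | P , perfect = 2≢1 (∣1⇒≡1 (∣m+n∣m⇒∣n 2∣C+1 2∣C─v))
  where
  2∣C─v : 2 ∣ count (C ─ v)
  2∣C─v = matched⇒even P _ (C ─ v) ≤-refl (perfect⇒matchedWithin {G = G} {P} {C ─ v} perfect)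
  2∣C+1 : 2 ∣ count (C ─ v) + 1
  2∣C+1 = subst (2 ∣_) (trans (count-remove v v∈C) (+-comm 1 (count (C ─ v)))) 2∣C
  2≢1 : 2 ≢ 1
  2≢1 ()

n≤4⌈n/4⌉ : ∀ n → n ≤ 4 * ⌈ n /4⌉
n≤4⌈n/4⌉ n = +-cancelˡ-≤ 3 n (4 * q) (begin
  3 + n               ≡⟨ +-comm 3 n ⟩
  n + 3               ≡⟨ m≡m%n+[m/n]*n (n + 3) 4 ⟩
  (n + 3) % 4 + q * 4 ≤⟨ +-monoˡ-≤ (q * 4) (≤-pred (m%n<n (n + 3) 4)) ⟩
  3 + q * 4           ≡⟨ cong (3 +_) (*-comm q 4) ⟩
  3 + 4 * q           ∎)
  where
  q = ⌈ n /4⌉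
  open ≤-Reasoning

-- An odd c with 2c ≤ n is below 2⌈n/4⌉ (as 2⌈n/4⌉ is even and ≥ n/2), so
-- it cannot bound a sum of two numbers that are both at least ⌈n/4⌉.
odd-half-too-small : ∀ n c a b → ¬ 2 ∣ c → 2 * c ≤ n → a + b ≤ c →
  ⌈ n /4⌉ ≤ a → ⌈ n /4⌉ ≤ b → ⊥
odd-half-too-small n c a b odd 2c≤n a+b≤c q≤a q≤b =
  odd (subst (2 ∣_) (≤-antisym 2q≤c c≤2q) (m∣m*n q))
  where
  q = ⌈ n /4⌉
  c≤2q : c ≤ 2 * q
  c≤2q = *-cancelˡ-≤ 2 (≤-trans 2c≤n (≤-trans (n≤4⌈n/4⌉ n) (≤-reflexive (*-assoc 2 2 q))))
  2q≤c : 2 * q ≤ c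
  2q≤c = ≤-trans (≤-reflexive (cong (q +_) (+-identityʳ q))) (≤-trans (+-mono-≤ q≤a q≤b) a+b≤c)

swap-components : ∀ {n} {G : Graph n} {A B : VSet n} →
  TwoComponents G A B → TwoComponents G B A
swap-components {G = G} (partition , connected-A , connected-B , no-edges) =
  Sum.swap ∘ Sum.map Product.swap Product.swap ∘ partition ,
  connected-B , connected-A ,
  λ u v u∈B v∈A → trans (Graph.sym G u v) (no-edges v u v∈A u∈B)

component-closed : ∀ {n} {G : Graph n} {A B : VSet n} {x w} →
  TwoComponents G A B → x ∈ A → adj G x w ≡ true → w ∈ A
component-closed {w = w} (partition , _ , _ , no-edges) x∈A xw∈G with partition w
... | inj₁ (w∈A , _) = w∈A
... | inj₂ (_ , w∈B) = ⊥-elim (false≢true (trans (sym (no-edges _ w x∈A w∈B)) xw∈G))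

components-disjoint : ∀ {n} {G : Graph n} {A B : VSet n} {v} →
  TwoComponents G A B → v ∈ A → v ∈ B → ⊥
components-disjoint {v = v} (partition , _) v∈A v∈B with partition v
... | inj₁ (_ , v∉B) = v∉B v∈B
... | inj₂ (v∉A , _) = v∉A v∈A

other-component : ∀ {n} {G : Graph n} {A B : VSet n} {v} →
  TwoComponents G A B → ¬ v ∈ A → v ∈ B
other-component {v = v} (partition , _) v∉A with partition v
... | inj₁ (v∈A , _) = ⊥-elim (v∉A v∈A)
... | inj₂ (_ , v∈B) = v∈B

smaller-component : ∀ {n} {G : Graph n} {A B : VSet n} →
  TwoComponents G A B → size A ≤ size B → 2 * count A ≤ n
smaller-component {n} {A = A} {B} components |A|≤|B| = begin
  2 * count A       ≡⟨ cong (count A +_) (+-identityʳ (count A)) ⟩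
  count A + count A ≤⟨ +-monoʳ-≤ (count A) (subst₂ _≤_ (size≡count A) (size≡count B) |A|≤|B|) ⟩
  count A + count B ≤⟨ count-disjoint {S = A} {B} {V} (λ _ _ → refl) (λ _ _ → refl)
                         (λ _ → components-disjoint components) ⟩
  count (V {n})     ≡⟨ count-V {n} ⟩
  n                 ∎
  where open ≤-Reasoning

-- The smaller component, if factor-critical, has odd order at most n/2, so
-- it cannot contain two disjoint vertex sets of size ≥ ⌈n/4⌉.
no-two-large-parts : ∀ {n} {G : Graph n} {C D : VSet n} →
  TwoComponents G C D → FactorCritical G C → size C ≤ size D →
  (P Q : VSet n) → P ⊆ C → Q ⊆ C → (∀ v → v ∈ P → v ∈ Q → ⊥) →
  ⌈ n /4⌉ ≤ count P → ⌈ n /4⌉ ≤ count Q → ⊥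
no-two-large-parts {n} {G} {C} components critical |C|≤|D| P Q P⊆C Q⊆C disjoint =
  odd-half-too-small n _ (count P) (count Q)
    (factorCritical⇒odd {G = G} {C} critical (proj₂ (proj₁ (proj₁ (proj₂ components)))))
    (smaller-component components |C|≤|D|)
    (count-disjoint P⊆C Q⊆C disjoint)

degree≤ : ∀ {n} (G : Graph n) {X : VSet n} {x m} → x ∈ X →
  (∀ w → adj G x w ≡ true → w ∈ X ⊎ w ≡ m) → degree G x ≤ count X
degree≤ G {X} {x} {m} x∈X neighbours = begin
  degree G x          ≡⟨ size≡count (adj G x) ⟩
  count (adj G x)     ≤⟨ +-cancelʳ-≤ 1 _ _ (subst₂ (λ a b → count (adj G x) + a ≤ count X + b)
                           (count-⁅⁆ x) (count-⁅⁆ m)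
                           (count-compare (adj G x) ⁅ x ⁆ X ⁅ m ⁆ pointwise)) ⟩
  count X             ∎
  where
  open ≤-Reasoning
  pointwise : ∀ w → ι (adj G x w) + ι (⁅ x ⁆ w) ≤ ι (X w) + ι (⁅ m ⁆ w)
  pointwise w with w F.≟ x
  ... | yes refl rewrite irrfl G w | x∈X = s≤s z≤n
  ... | no _ with adj G x w in xw∈G
  ...   | false = z≤n
  ...   | true with neighbours w xw∈G
  ...     | inj₁ w∈X rewrite w∈X = s≤s z≤n
  ...     | inj₂ refl rewrite ⁅⁆-self w = m≤n+m 1 (ι (X w))

H-edge-survives : ∀ {n} {H M M' : Graph n} {x w} → adj H x w ≡ true → adj M' x w ≡ false →
  adj ((H ∪E M) ∖E M') x w ≡ true
H-edge-survives xw∈H xw∉M' rewrite xw∈H | xw∉M' = refl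

M-edge-survives : ∀ {n} {H M M' : Graph n} {x w} → adj M x w ≡ true → adj M' x w ≡ false →
  adj ((H ∪E M) ∖E M') x w ≡ true
M-edge-survives {H = H} {x = x} {w} xw∈M xw∉M'
  rewrite xw∈M | ∨-zeroʳ (adj H x w) | xw∉M' = refl

-- If a component A of H and a component A' of G' = (H ∪ M) − M' share a
-- vertex x, then |A ∩ A'| ≥ deg_H(x): x and all its H-neighbours except its
-- M'-partner lie in both components.
shared-vertex⇒large : ∀ {n} (H M M' : Graph n) {A B A' B' : VSet n} {x} →
  IsPerfectMatching (H ∪E M) V M' →
  TwoComponents H A B → TwoComponents ((H ∪E M) ∖E M') A' B' →
  x ∈ A → x ∈ A' → degree H x ≤ count (A ∩ A')
shared-vertex⇒large H M M' {A} {_} {A'} {_} {x} (_ , partner) components components' x∈A x∈A' =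
  degree≤ H (∩-intro {A = A} {A'} x∈A x∈A') neighbours
  where
  neighbours : ∀ w → adj H x w ≡ true → w ∈ (A ∩ A') ⊎ w ≡ proj₁ (partner x refl)
  neighbours w xw∈H with adj M' x w in xw∈M'
  ... | true = inj₂ (proj₂ (proj₂ (partner x refl)) w xw∈M')
  ... | false = inj₁ (∩-intro {A = A} {A'} (component-closed components x∈A xw∈H)
                        (component-closed components' x∈A' (H-edge-survives {H = H} {M} {M'} xw∈H xw∈M')))

lemma3p2 : (n : ℕ) → 2 ∣ n → (H : Graph n) → (∀ v → ⌈ n /4⌉ ≤ degree H v) →
    (C₁ C₂ : VSet n) → TwoComponents H C₁ C₂ →
    FactorCritical H C₁ → FactorCritical H C₂ → size C₁ ≤ size C₂ →
    (M : Graph n) → IsPerfectMatching (complement H) V M →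
    (M' : Graph n) → IsPerfectMatching (H ∪E M) V M' →
    (C₁' C₂' : VSet n) → TwoComponents ((H ∪E M) ∖E M') C₁' C₂' →
    FactorCritical ((H ∪E M) ∖E M') C₁' → FactorCritical ((H ∪E M) ∖E M') C₂' →
    size C₁' ≤ size C₂' →
    (∃[ u ] ∃[ v ] (u ∈ C₁ × v ∈ C₂ × adj M u v ≡ true × adj M' u v ≡ false)) →
    (∀ v → v ∈ C₁' → v ∈ C₂) × (∃[ v ] (v ∈ C₂ × v ∈ C₂'))
lemma3p2 n _ H δ C₁ C₂ components critical₁ _ |C₁|≤|C₂| M _ M' perfect' C₁' C₂' components'
  critical₁' _ |C₁'|≤|C₂'| (u , v , u∈C₁ , v∈C₂ , uv∈M , uv∉M') = C₁'⊆C₂ , v , v∈C₂ , v∈C₂'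
  where
  uv∈G' : adj ((H ∪E M) ∖E M') u v ≡ true
  uv∈G' = M-edge-survives {H = H} {M} {M'} uv∈M uv∉M'
  large : ∀ {A B A' B'} x → TwoComponents H A B → TwoComponents ((H ∪E M) ∖E M') A' B' →
    x ∈ A → x ∈ A' → ⌈ n /4⌉ ≤ count (A ∩ A')
  large x c c' x∈A x∈A' = ≤-trans (δ x) (shared-vertex⇒large H M M' perfect' c c' x∈A x∈A')
  -- otherwise C₁' would contain the large disjoint sets C₁ ∩ C₁' and C₂ ∩ C₁'
  u∉C₁' : ¬ u ∈ C₁'
  u∉C₁' u∈C₁' = no-two-large-parts components' critical₁' |C₁'|≤|C₂'| (C₁ ∩ C₁') (C₂ ∩ C₁')
    (∩-elimʳ C₁ C₁') (∩-elimʳ C₂ C₁')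
    (λ w p q → components-disjoint components (∩-elimˡ C₁ C₁' w p) (∩-elimˡ C₂ C₁' w q))
    (large u components components' u∈C₁ u∈C₁')
    (large v (swap-components components) components' v∈C₂ (component-closed components' u∈C₁' uv∈G'))
  u∈C₂' : u ∈ C₂'
  u∈C₂' = other-component components' u∉C₁'
  v∈C₂' : v ∈ C₂'
  v∈C₂' = component-closed (swap-components components') u∈C₂' uv∈G'
  -- otherwise C₁ would contain the large disjoint sets C₁ ∩ C₁' and C₁ ∩ C₂'
  C₁'⊆C₂ : ∀ x → x ∈ C₁' → x ∈ C₂
  C₁'⊆C₂ x x∈C₁' = other-component components λ x∈C₁ →
    no-two-large-parts components critical₁ |C₁|≤|C₂| (C₁ ∩ C₁') (C₁ ∩ C₂')
      (∩-elimˡ C₁ C₁') (∩-elimˡ C₁ C₂')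
      (λ w p q → components-disjoint components' (∩-elimʳ C₁ C₁' w p) (∩-elimʳ C₁ C₂' w q))
      (large x components components' x∈C₁ x∈C₁')
      (large u components (swap-components components') u∈C₁ u∈C₂')
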